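{- Every forest $T$ satisfies $s(T)\le3$. If a graph $G$ has an $I,F$-partition, then $s(G)\le4$. More generally, if $V(G)$ can be partitioned into sets $F,I_1,\dots,I_k$ such that $G[F]$ is a forest and, for each $j\in\{1,\dots,k\}$, $I_j$ is a $2$-independent set in the induced subgraph $G[F\cup I_1\cup\cdots\cup I_j]$, then $s(G)\le k+3$.
   Context: Graphs are finite and simple. A star coloring is a proper vertex coloring in which no path on four vertices receives only two colors (equivalently, the union of any two color classes induces a forest of stars); $s(G)$ is the minimum number of colors in a star coloring of $G$. A set $I$ of vertices of a graph $H$ is $2$-independent in $H$ if any two vertices of $I$ are at distance greater than $2$ in $H$. An $I,F$-partition of $G$ is a partition of $V(G)$ into sets $I$ and $F$ such that $I$ is $2$-independent in $G$ and $G[F]$ is a forest. -}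

module Defs where

open import Data.Nat using (ℕ; zero; suc; _+_; _≤_; _≤ᵇ_; _≡ᵇ_)
open import Data.Fin using (Fin; zero; suc; toℕ; inject₁; fromℕ)
open import Data.Bool using (Bool; true; false; not)
open import Data.Product using (Σ; ∃; _×_; _,_)
open import Data.Sum using (_⊎_)
open import Relation.Binary.PropositionalEquality using (_≡_; _≢_)
open import Relation.Nullary using (¬_)
open import Function.Definitions using (Injective)

record Graph (n : ℕ) : Set where
  field
    adj    : Fin n → Fin n → Bool
    sym    : ∀ u v → adj u v ≡ adj v u
    irrefl : ∀ v → adj v v ≡ false

open Graph public

Adj : ∀ {n} → Graph n → Fin n → Fin n → Set
Adj G u v = adj G u v ≡ true

VSet : ℕ → Set
VSet n = Fin n → Bool

-- A cycle (length ≥ 3, distinct vertices) in the induced subgraph G[S].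
-- Vertices c 0, c 1, ..., c (l+2); edges c i ~ c (i+1) and c (l+2) ~ c 0.
record CycleIn {n : ℕ} (G : Graph n) (S : VSet n) : Set where
  field
    l      : ℕ
    c      : Fin (3 + l) → Fin n
    inj    : Injective _≡_ _≡_ c
    inS    : ∀ i → S (c i) ≡ true
    step   : ∀ (i : Fin (2 + l)) → Adj G (c (inject₁ i)) (c (suc i))
    close  : Adj G (c (fromℕ (2 + l))) (c zero)

InducedForest : ∀ {n} → Graph n → VSet n → Set
InducedForest G S = ¬ CycleIn G S

IsForest : ∀ {n} → Graph n → Set
IsForest G = InducedForest G (λ _ → true)

-- I is 2-independent in G[S] (I ⊆ S assumed by the caller): any two
-- distinct vertices of I are at distance > 2 in G[S], i.e. they are
-- non-adjacent and have no common neighbour inside S.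
TwoIndependentIn : ∀ {n} → Graph n → (S I : VSet n) → Set
TwoIndependentIn G S I =
  ∀ u v → I u ≡ true → I v ≡ true → u ≢ v →
    ¬ Adj G u v × (∀ w → S w ≡ true → ¬ (Adj G u w × Adj G w v))

record StarColoring {n : ℕ} (G : Graph n) (m : ℕ) : Set where
  field
    col    : Fin n → Fin m
    proper : ∀ u v → Adj G u v → col u ≢ col v
    noBicoloredP4 : ∀ a b c d →
      a ≢ b → a ≢ c → a ≢ d → b ≢ c → b ≢ d → c ≢ d →
      Adj G a b → Adj G b c → Adj G c d →
      ¬ (Σ (Fin m) λ x → Σ (Fin m) λ y →
           ∀ v → (v ≡ a ⊎ v ≡ b ⊎ v ≡ c ⊎ v ≡ d) → (col v ≡ x ⊎ col v ≡ y))

StarChromatic≤ : ∀ {n} → Graph n → ℕ → Set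
StarChromatic≤ G m = StarColoring G m

IFPartition : ∀ {n} → Graph n → VSet n → Set
IFPartition G I =
  TwoIndependentIn G (λ _ → true) I × InducedForest G (λ v → not (I v))

-- A partition of V(G) into F, I_1, ..., I_k, encoded by a part map
-- p : Fin n → Fin (suc k) with F = p⁻¹(0) and I_j = p⁻¹(j) (j = 1..k).
-- Membership in F ∪ I_1 ∪ ... ∪ I_j : toℕ (p v) ≤ j.
UpTo : ∀ {n k} → (Fin n → Fin (suc k)) → ℕ → VSet n
UpTo p j v = toℕ (p v) ≤ᵇ j

Part : ∀ {n k} → (Fin n → Fin (suc k)) → Fin (suc k) → VSet n
Part p j v = toℕ (p v) ≡ᵇ toℕ j

LayeredPartition : ∀ {n} → Graph n → (k : ℕ) → (Fin n → Fin (suc k)) → Set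
LayeredPartition G k p =
  InducedForest G (Part p zero) ×
  (∀ (j : Fin k) → TwoIndependentIn G (UpTo p (suc (toℕ j))) (Part p (suc j)))

module Submission where

-- Root every tree of the forest F and colour a vertex of F by its depth modulo 3; each layer I_j gets one
-- further colour of its own. Along an edge of F the depth changes by one and every vertex has at most one
-- neighbour of smaller depth (its parent), so a path a–b–c in F whose ends share a colour has b as the parent of
-- both; a bicoloured path a–b–c–d in F would then make b and c each the parent of the other. The depths
-- are built by removing leaves; a leaf exists because in a forest without one a non-backtracking walk
-- would revisit a vertex and close a cycle.

open import Defs
open import Data.Bool using (true; false; not; T; if_then_else_)
import Data.Bool as Bool
open import Data.Bool.Properties using (T-≡)
open import Data.Empty using (⊥; ⊥-elim)
open import Data.Fin using (Fin; zero; suc; toℕ; inject₁; fromℕ; join; splitAt; _≟_)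
open import Data.Fin.Properties
  using (any?; pigeonhole; toℕ-injective; toℕ<n; toℕ-inject₁; toℕ-fromℕ; splitAt-join)
open import Data.Fin.Subset using (∣_∣; _∈_)
open import Data.Fin.Subset.Properties using (p⊂q⇒∣p∣<∣q∣)
open import Data.Nat using (ℕ; zero; suc; _+_; _≤_; _<_)
open import Data.Nat.Induction using (<-wellFounded; <-rec)
open import Data.Nat.Properties
  using ( n<1+n; m≢1+n+m; n≤0⇒n≡0; <-cmp; +-monoˡ-<; +-comm; m≤n⇒∃[o]m+o≡n; anyUpTo?; ≤-total
        ; ≡⇒≡ᵇ; ≤⇒≤ᵇ)
open import Data.Product using (∃; ∃₂; _×_; _,_; proj₁; proj₂)
open import Data.Sum using (_⊎_; inj₁; inj₂)
open import Data.Sum.Properties using (inj₁-injective; inj₂-injective)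
open import Data.Vec using (tabulate)
open import Data.Vec.Properties using (lookup∘tabulate; []=⇒lookup; lookup⇒[]=)
open import Data.Vec.Functional using (updateAt)
open import Data.Vec.Functional.Properties using (updateAt-updates; updateAt-minimal)
open import Function using (const; _∘_; Injective)
open import Function.Bundles using (Equivalence)
open import Induction.WellFounded using (module All)
import Relation.Binary.Construct.On as On
open import Relation.Binary.PropositionalEquality as ≡ using (_≡_; _≢_; refl; cong; subst; trans)
open import Relation.Binary using (tri<; tri≈; tri>; DecidableEquality)
open import Relation.Nullary using (¬_; Dec; yes; no; ¬?)
open import Relation.Nullary.Decidable using (_×-dec_; decidable-stable)

_⊆_ : ∀ {n} → VSet n → VSet n → Set
S ⊆ S′ = ∀ v → S v ≡ true → S′ v ≡ true

size : ∀ {n} → VSet n → ℕ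
size S = ∣ tabulate S ∣

module _ {n : ℕ} {S : VSet n} where

  ∈-tabulate⁺ : ∀ {v} → S v ≡ true → v ∈ tabulate S
  ∈-tabulate⁺ {v} v∈S = lookup⇒[]= v (tabulate S) (trans (lookup∘tabulate S v) v∈S)

  ∈-tabulate⁻ : ∀ {v} → v ∈ tabulate S → S v ≡ true
  ∈-tabulate⁻ {v} v∈ = trans (≡.sym (lookup∘tabulate S v)) ([]=⇒lookup v∈)

size-< : ∀ {n} {S S′ : VSet n} {v} → S′ ⊆ S → S v ≡ true → ¬ S′ v ≡ true → size S′ < size S
size-< {S = S} {S′} S′⊆S v∈S v∉S′ = p⊂q⇒∣p∣<∣q∣
  ( (λ w∈S′ → ∈-tabulate⁺ (S′⊆S _ (∈-tabulate⁻ w∈S′)))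
  , _ , ∈-tabulate⁺ v∈S , v∉S′ ∘ ∈-tabulate⁻ {S = S′})

remove : ∀ {n} → VSet n → Fin n → VSet n
remove S v = updateAt S v (const false)

module _ {n : ℕ} (S : VSet n) (v : Fin n) where

  remove-∌ : ¬ remove S v v ≡ true
  remove-∌ v∈ with trans (≡.sym (updateAt-updates v S)) v∈
  ... | ()

  remove-⊆ : remove S v ⊆ S
  remove-⊆ w w∈ with w ≟ v
  ... | yes refl = ⊥-elim (remove-∌ w∈)
  ... | no w≢v = trans (≡.sym (updateAt-minimal w v S w≢v)) w∈

  remove-∋ : ∀ {w} → w ≢ v → S w ≡ true → remove S v w ≡ true
  remove-∋ {w} w≢v w∈S = trans (updateAt-minimal w v S w≢v) w∈S

mod3 : ℕ → Fin 3
mod3 zero = zero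
mod3 (suc zero) = suc zero
mod3 (suc (suc zero)) = suc (suc zero)
mod3 (suc (suc (suc m))) = mod3 m

mod3-suc≢ : ∀ m → mod3 (suc m) ≢ mod3 m
mod3-suc≢ zero ()
mod3-suc≢ (suc zero) ()
mod3-suc≢ (suc (suc zero)) ()
mod3-suc≢ (suc (suc (suc m))) = mod3-suc≢ m

mod3-2+≢ : ∀ m → mod3 (2 + m) ≢ mod3 m
mod3-2+≢ zero ()
mod3-2+≢ (suc zero) ()
mod3-2+≢ (suc (suc zero)) ()
mod3-2+≢ (suc (suc (suc m))) = mod3-2+≢ m

twoValued-≢-≢⇒≡ : ∀ {A : Set} {x y a b c : A} → a ≢ b → b ≢ c →
  a ≡ x ⊎ a ≡ y → b ≡ x ⊎ b ≡ y → c ≡ x ⊎ c ≡ y → a ≡ c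
twoValued-≢-≢⇒≡ a≢b _   (inj₁ refl) (inj₁ refl) _           = ⊥-elim (a≢b refl)
twoValued-≢-≢⇒≡ a≢b _   (inj₂ refl) (inj₂ refl) _           = ⊥-elim (a≢b refl)
twoValued-≢-≢⇒≡ _   _   (inj₁ refl) (inj₂ refl) (inj₁ refl) = refl
twoValued-≢-≢⇒≡ _   b≢c (inj₁ refl) (inj₂ refl) (inj₂ refl) = ⊥-elim (b≢c refl)
twoValued-≢-≢⇒≡ _   _   (inj₂ refl) (inj₁ refl) (inj₂ refl) = refl
twoValued-≢-≢⇒≡ _   b≢c (inj₂ refl) (inj₁ refl) (inj₁ refl) = ⊥-elim (b≢c refl)

module _ {A : Set} (f : ℕ → A) where

  Repeat : ℕ → Set
  Repeat j = ∃ λ i → i < j × f i ≡ f j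

  DistinctBelow : ℕ → Set
  DistinctBelow j = ∀ {x y} → x < y → y < j → f x ≢ f y

  earliestRepeat : DecidableEquality A → ∀ j → Repeat j → ∃ λ j′ → Repeat j′ × DistinctBelow j′
  earliestRepeat _≟ᴬ_ = <-rec _ search
    where
      search : ∀ j → (∀ {y} → y < j → Repeat y → ∃ λ j′ → Repeat j′ × DistinctBelow j′) →
               Repeat j → ∃ λ j′ → Repeat j′ × DistinctBelow j′
      search j earlier r with anyUpTo? (λ y → anyUpTo? (λ x → f x ≟ᴬ f y) y) j
      ... | yes (y , y<j , ry) = earlier y<j ry
      ... | no none = j , r , λ x<y y<j fx≡fy → none (_ , y<j , _ , x<y , fx≡fy)

module _ {n : ℕ} (G : Graph n) where

  adj-sym : ∀ {u v} → Adj G u v → Adj G v u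
  adj-sym {u} {v} u~v = trans (≡.sym (sym G u v)) u~v

  adj-irrefl : ∀ {v} → ¬ Adj G v v
  adj-irrefl {v} v~v with trans (≡.sym (irrefl G v)) v~v
  ... | ()

  adj⇒≢ : ∀ {u v} → Adj G u v → u ≢ v
  adj⇒≢ u~v refl = adj-irrefl u~v

  adj? : ∀ u v → Dec (Adj G u v)
  adj? u v = adj G u v Bool.≟ true

  cycle-⊆ : ∀ {S S′} → S ⊆ S′ → CycleIn G S → CycleIn G S′
  cycle-⊆ S⊆S′ C = record
    { l = l ; c = c ; inj = inj ; inS = λ i → S⊆S′ (c i) (inS i) ; step = step ; close = close }
    where open CycleIn C

  forest-⊆ : ∀ {S S′} → S ⊆ S′ → InducedForest G S′ → InducedForest G S
  forest-⊆ S⊆S′ forest = forest ∘ cycle-⊆ S⊆S′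

  twoIndependent-⊆ : ∀ {S S′ I I′} → S′ ⊆ S → I′ ⊆ I →
                     TwoIndependentIn G S I → TwoIndependentIn G S′ I′
  twoIndependent-⊆ S′⊆S I′⊆I independent u v u∈I′ v∈I′ u≢v =
    let nonadjacent , noCommonNeighbour = independent u v (I′⊆I u u∈I′) (I′⊆I v v∈I′) u≢v
    in nonadjacent , λ w w∈S′ → noCommonNeighbour w (S′⊆S w w∈S′)

  module _ {S : VSet n} (w : ℕ → Fin n)
           (w∈S : ∀ i → S (w i) ≡ true) (w~ : ∀ i → Adj G (w i) (w (suc i))) where

    closedWalk⇒cycle : ∀ i l → w (3 + l + i) ≡ w i →
      (∀ {x y} → x < y → y < 3 + l → w (x + i) ≢ w (y + i)) → CycleIn G S
    closedWalk⇒cycle i l closed distinct = record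
      { l = l ; c = c ; inj = c-injective ; inS = λ k → w∈S (toℕ k + i) ; step = step ; close = close }
      where
        c : Fin (3 + l) → Fin n
        c k = w (toℕ k + i)
        c-injective : Injective _≡_ _≡_ c
        c-injective {k} {k′} eq with <-cmp (toℕ k) (toℕ k′)
        ... | tri< lt _ _ = ⊥-elim (distinct lt (toℕ<n k′) eq)
        ... | tri≈ _ e _ = toℕ-injective e
        ... | tri> _ _ gt = ⊥-elim (distinct gt (toℕ<n k) (≡.sym eq))
        step : ∀ (k : Fin (2 + l)) → Adj G (c (inject₁ k)) (c (suc k))
        step k rewrite toℕ-inject₁ k = w~ (toℕ k + i)
        close : Adj G (c (fromℕ (2 + l))) (c zero)
        close rewrite toℕ-fromℕ l = subst (Adj G (w (2 + l + i))) closed (w~ (2 + l + i))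

    module _ (nonBacktracking : ∀ i → w (2 + i) ≢ w i) where

      closedSegment⇒cycle : ∀ i d → w (suc d + i) ≡ w i → DistinctBelow w (suc d + i) → CycleIn G S
      closedSegment⇒cycle i zero closed _ = ⊥-elim (adj-irrefl (subst (Adj G (w i)) closed (w~ i)))
      closedSegment⇒cycle i (suc zero) closed _ = ⊥-elim (nonBacktracking i closed)
      closedSegment⇒cycle i (suc (suc l)) closed distinct =
        closedWalk⇒cycle i l closed λ x<y y<3+l → distinct (+-monoˡ-< i x<y) (+-monoˡ-< i y<3+l)

      nonBacktracking⇒cycle : CycleIn G S
      nonBacktracking⇒cycle with pigeonhole (n<1+n n) (w ∘ toℕ)
      ... | i , j , i<j , wi≡wj with earliestRepeat w _≟_ (toℕ j) (toℕ i , i<j , wi≡wj)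
      ... | j′ , (i′ , i′<j′ , repeat) , distinct with m≤n⇒∃[o]m+o≡n i′<j′
      ... | d , refl rewrite +-comm i′ d = closedSegment⇒cycle i′ d (≡.sym repeat) distinct

  TwoNeighboursIn : VSet n → Fin n → Set
  TwoNeighboursIn S v = ∃₂ λ a b → ((S a ≡ true × Adj G v a) × (S b ≡ true × Adj G v b)) × a ≢ b

  twoNeighbours? : ∀ S v → Dec (TwoNeighboursIn S v)
  twoNeighbours? S v = any? λ a → any? λ b →
    (((S a Bool.≟ true) ×-dec adj? v a) ×-dec ((S b Bool.≟ true) ×-dec adj? v b)) ×-dec ¬? (a ≟ b)

  IsLeafIn : VSet n → Fin n → Set
  IsLeafIn S v = ∀ {a b} → S a ≡ true → S b ≡ true → Adj G v a → Adj G v b → a ≡ b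

  ¬twoNeighbours⇒leaf : ∀ {S v} → ¬ TwoNeighboursIn S v → IsLeafIn S v
  ¬twoNeighbours⇒leaf ¬two {a} {b} a∈S b∈S v~a v~b with a ≟ b
  ... | yes a≡b = a≡b
  ... | no a≢b = ⊥-elim (¬two (a , b , ((a∈S , v~a) , (b∈S , v~b)) , a≢b))

  anotherNeighbour : ∀ {S v} → TwoNeighboursIn S v → ∀ u → ∃ λ w → (S w ≡ true × Adj G v w) × w ≢ u
  anotherNeighbour (a , b , (a∈ , b∈) , a≢b) u with a ≟ u
  ... | yes refl = b , b∈ , a≢b ∘ ≡.sym
  ... | no a≢u = a , a∈ , a≢u

  module _ {S : VSet n} (branching : ∀ v → S v ≡ true → TwoNeighboursIn S v) where

    private
      record Arc : Set where
        field
          previous current : Fin n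
          current∈S : S current ≡ true

      open Arc

      next : (a : Arc) → ∃ λ w → (S w ≡ true × Adj G (current a) w) × w ≢ previous a
      next a = anotherNeighbour (branching (current a) (current∈S a)) (previous a)

      proceed : Arc → Arc
      proceed a = record
        { previous = current a ; current = proj₁ (next a) ; current∈S = proj₁ (proj₁ (proj₂ (next a))) }

    branching⇒cycle : ∀ {s} → S s ≡ true → CycleIn G S
    branching⇒cycle {s} s∈S = nonBacktracking⇒cycle walk (current∈S ∘ arcs) adjacent nonBacktracking
      where
        arcs : ℕ → Arc
        arcs zero = record { previous = s ; current = s ; current∈S = s∈S }
        arcs (suc i) = proceed (arcs i)
        walk : ℕ → Fin n
        walk = current ∘ arcs
        adjacent : ∀ i → Adj G (walk i) (walk (suc i))
        adjacent i = proj₂ (proj₁ (proj₂ (next (arcs i))))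
        nonBacktracking : ∀ i → walk (2 + i) ≢ walk i
        nonBacktracking i = proj₂ (proj₂ (next (arcs (suc i))))

  forest⇒leaf : ∀ {S s} → InducedForest G S → S s ≡ true → ∃ λ v → S v ≡ true × IsLeafIn S v
  forest⇒leaf {S} forest s∈S with any? (λ v → (S v Bool.≟ true) ×-dec ¬? (twoNeighbours? S v))
  ... | yes (v , v∈S , ¬two) = v , v∈S , ¬twoNeighbours⇒leaf ¬two
  ... | no noLeaf = ⊥-elim (forest (branching⇒cycle branching s∈S))
    where
      branching : ∀ v → S v ≡ true → TwoNeighboursIn S v
      branching v v∈S = decidable-stable (twoNeighbours? S v) λ ¬two → noLeaf (v , v∈S , ¬two)

  record IsLevelling (S : VSet n) (h : Fin n → ℕ) : Set where
    field
      edge-levels : ∀ {u v} → S u ≡ true → S v ≡ true → Adj G u v → h v ≡ suc (h u) ⊎ h u ≡ suc (h v)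
      unique-parent : ∀ {v a b} → S v ≡ true → S a ≡ true → S b ≡ true → Adj G v a → Adj G v b →
                      suc (h a) ≡ h v → suc (h b) ≡ h v → a ≡ b

  empty-levelling : ∀ {S} → (∀ v → ¬ S v ≡ true) → IsLevelling S (const 0)
  empty-levelling empty = record
    { edge-levels = λ {u} u∈S _ _ → ⊥-elim (empty u u∈S)
    ; unique-parent = λ {v} v∈S _ _ _ _ _ _ → ⊥-elim (empty v v∈S) }

  module _ {S : VSet n} {v : Fin n} {h′ : Fin n → ℕ} (leaf : IsLeafIn S v)
           (levelling : IsLevelling (remove S v) h′)
           (hv : ℕ) (below-hv : ∀ {u} → S u ≡ true → Adj G v u → suc (h′ u) ≡ hv) where

    open IsLevelling levelling

    private
      h : Fin n → ℕ
      h = updateAt h′ v (const hv)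

      h-at : h v ≡ hv
      h-at = updateAt-updates v h′

      h-off : ∀ {w} → w ≢ v → h w ≡ h′ w
      h-off {w} w≢v = updateAt-minimal w v h′ w≢v

      extend-edge-levels : ∀ {x y} → S x ≡ true → S y ≡ true → Adj G x y →
                           h y ≡ suc (h x) ⊎ h x ≡ suc (h y)
      extend-edge-levels {x} {y} x∈S y∈S x~y with x ≟ v | y ≟ v
      ... | yes refl | yes refl = ⊥-elim (adj-irrefl x~y)
      ... | yes refl | no y≢v =
        inj₂ (trans h-at (≡.sym (trans (cong suc (h-off y≢v)) (below-hv y∈S x~y))))
      ... | no x≢v | yes refl =
        inj₁ (trans h-at (≡.sym (trans (cong suc (h-off x≢v)) (below-hv x∈S (adj-sym x~y)))))
      ... | no x≢v | no y≢v rewrite h-off x≢v | h-off y≢v =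
        edge-levels (remove-∋ S v x≢v x∈S) (remove-∋ S v y≢v y∈S) x~y

      not-parent : ∀ {x} → x ≢ v → S x ≡ true → Adj G x v → suc (h v) ≢ h x
      not-parent {x} x≢v x∈S x~v parent = m≢1+n+m (h′ x) (begin
        h′ x              ≡⟨ h-off x≢v ⟨
        h x               ≡⟨ parent ⟨
        suc (h v)         ≡⟨ cong suc h-at ⟩
        suc hv            ≡⟨ cong suc (below-hv x∈S (adj-sym x~v)) ⟨
        suc (suc (h′ x))  ∎)
        where open ≡.≡-Reasoning

      extend-unique-parent : ∀ {x a b} → S x ≡ true → S a ≡ true → S b ≡ true → Adj G x a → Adj G x b →
                             suc (h a) ≡ h x → suc (h b) ≡ h x → a ≡ b
      extend-unique-parent {x} {a} {b} x∈S a∈S b∈S x~a x~b a-parent b-parent with x ≟ v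
      ... | yes refl = leaf a∈S b∈S x~a x~b
      ... | no x≢v =
        unique-parent (remove-∋ S v x≢v x∈S) (remove-∋ S v a≢v a∈S) (remove-∋ S v b≢v b∈S) x~a x~b
                       (≡.subst₂ (λ ha hx → suc ha ≡ hx) (h-off a≢v) (h-off x≢v) a-parent)
                       (≡.subst₂ (λ hb hx → suc hb ≡ hx) (h-off b≢v) (h-off x≢v) b-parent)
        where
          a≢v : a ≢ v
          a≢v refl = not-parent x≢v x∈S x~a a-parent
          b≢v : b ≢ v
          b≢v refl = not-parent x≢v x∈S x~b b-parent

    extend-levelling : IsLevelling S h
    extend-levelling = record { edge-levels = extend-edge-levels ; unique-parent = extend-unique-parent }

  leaf-level : ∀ {S v} (h′ : Fin n → ℕ) → IsLeafIn S v →
               ∃ λ hv → ∀ {u} → S u ≡ true → Adj G v u → suc (h′ u) ≡ hv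
  leaf-level {S} {v} h′ leaf with any? (λ u → (S u Bool.≟ true) ×-dec adj? v u)
  ... | yes (u , u∈S , v~u) = suc (h′ u) , λ w∈S v~w → cong (suc ∘ h′) (leaf w∈S u∈S v~w v~u)
  ... | no isolated = 0 , λ {u} u∈S v~u → ⊥-elim (isolated (u , u∈S , v~u))

  forest⇒levelling : ∀ S → InducedForest G S → ∃ (IsLevelling S)
  forest⇒levelling = All.wfRec (On.wellFounded size <-wellFounded) _ _ levelling
    where
      levelling : ∀ S → (∀ {S′} → size S′ < size S → InducedForest G S′ → ∃ (IsLevelling S′)) →
                  InducedForest G S → ∃ (IsLevelling S)
      levelling S smaller forest with any? (λ s → S s Bool.≟ true)
      ... | no empty = const 0 , empty-levelling λ v v∈S → empty (v , v∈S)
      ... | yes (s , s∈S) with forest⇒leaf forest s∈S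
      ... | v , v∈S , leaf
        with smaller (size-< (remove-⊆ S v) v∈S (remove-∌ S v)) (forest-⊆ (remove-⊆ S v) forest)
      ... | h′ , levelling′ with leaf-level h′ leaf
      ... | hv , below-hv = _ , extend-levelling leaf levelling′ hv below-hv

  AlternatingP4 : {A : Set} → (Fin n → A) → Fin n → Fin n → Fin n → Fin n → Set
  AlternatingP4 col a b c d =
    (Adj G a b × Adj G b c × Adj G c d) × (a ≢ c × b ≢ d) × (col a ≡ col c × col b ≡ col d)

  module _ {S : VSet n} {h : Fin n → ℕ} (levelling : IsLevelling S h) where

    open IsLevelling levelling

    levelColour-proper : ∀ {u v} → S u ≡ true → S v ≡ true → Adj G u v → mod3 (h u) ≢ mod3 (h v)
    levelColour-proper {u} {v} u∈S v∈S u~v with edge-levels u∈S v∈S u~v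
    ... | inj₁ up rewrite up = mod3-suc≢ (h u) ∘ ≡.sym
    ... | inj₂ down rewrite down = mod3-suc≢ (h v)

    sameColourEnds⇒commonParent : ∀ {a b c} → S a ≡ true → S b ≡ true → S c ≡ true →
      Adj G a b → Adj G b c → a ≢ c → mod3 (h a) ≡ mod3 (h c) → suc (h b) ≡ h a × suc (h b) ≡ h c
    sameColourEnds⇒commonParent {a} {b} {c} a∈S b∈S c∈S a~b b~c a≢c same
      with edge-levels a∈S b∈S a~b | edge-levels b∈S c∈S b~c
    ... | inj₁ ab | inj₁ bc rewrite bc | ab = ⊥-elim (mod3-2+≢ (h a) (≡.sym same))
    ... | inj₁ ab | inj₂ cb =
      ⊥-elim (a≢c (unique-parent b∈S a∈S c∈S (adj-sym a~b) b~c (≡.sym ab) (≡.sym cb)))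
    ... | inj₂ ba | inj₁ bc = ≡.sym ba , ≡.sym bc
    ... | inj₂ ba | inj₂ cb rewrite ba | cb = ⊥-elim (mod3-2+≢ (h c) same)

    levelColour-noAlternatingP4 : ∀ {a b c d} → S a ≡ true → S b ≡ true → S c ≡ true → S d ≡ true →
      ¬ AlternatingP4 (mod3 ∘ h) a b c d
    levelColour-noAlternatingP4 {b = b} {c} a∈S b∈S c∈S d∈S ((a~b , b~c , c~d) , (a≢c , b≢d) , (ac , bd)) =
      m≢1+n+m (h b) (≡.sym (trans (cong suc b-parent-of-c) c-parent-of-b))
      where
        b-parent-of-c : suc (h b) ≡ h c
        b-parent-of-c = proj₂ (sameColourEnds⇒commonParent a∈S b∈S c∈S a~b b~c a≢c ac)
        c-parent-of-b : suc (h c) ≡ h b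
        c-parent-of-b = proj₁ (sameColourEnds⇒commonParent b∈S c∈S d∈S b~c c~d b≢d bd)

  starColouring : ∀ {A : Set} {m} (col : Fin n → A) (e : A → Fin m) → Injective _≡_ _≡_ e →
    (∀ {u v} → Adj G u v → col u ≢ col v) → (∀ {a b c d} → ¬ AlternatingP4 col a b c d) → StarColoring G m
  starColouring col e e-injective proper noAlternatingP4 = record
    { col = e ∘ col
    ; proper = λ _ _ u~v → proper′ u~v
    ; noBicoloredP4 = λ a b c d _ a≢c _ _ b≢d _ a~b b~c c~d (_ , _ , bicoloured) →
        let a-in = bicoloured a (inj₁ refl)
            b-in = bicoloured b (inj₂ (inj₁ refl))
            c-in = bicoloured c (inj₂ (inj₂ (inj₁ refl)))
            d-in = bicoloured d (inj₂ (inj₂ (inj₂ refl)))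
        in noAlternatingP4 ((a~b , b~c , c~d) , (a≢c , b≢d) ,
             e-injective (twoValued-≢-≢⇒≡ (proper′ a~b) (proper′ b~c) a-in b-in c-in) ,
             e-injective (twoValued-≢-≢⇒≡ (proper′ b~c) (proper′ c~d) b-in c-in d-in)) }
    where
      proper′ : ∀ {u v} → Adj G u v → e (col u) ≢ e (col v)
      proper′ u~v = proper u~v ∘ e-injective

layerColour : ∀ {k} → Fin (suc k) → ℕ → Fin k ⊎ Fin 3
layerColour zero    d = inj₂ (mod3 d)
layerColour (suc j) _ = inj₁ j

layerColour-layer : ∀ {k} (q q′ : Fin (suc k)) {d d′} → layerColour q d ≡ layerColour q′ d′ → q ≡ q′
layerColour-layer zero    zero     _  = refl
layerColour-layer (suc j) (suc j′) eq = cong suc (inj₁-injective eq)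
layerColour-layer zero    (suc _)  ()
layerColour-layer (suc _) zero     ()

join-injective : ∀ m n → Injective _≡_ _≡_ (join m n)
join-injective m n {i} {j} eq = begin
  i                        ≡⟨ splitAt-join m n i ⟨
  splitAt m (join m n i)   ≡⟨ cong (splitAt m) eq ⟩
  splitAt m (join m n j)   ≡⟨ splitAt-join m n j ⟩
  j                        ∎
  where open ≡.≡-Reasoning

T⇒≡true : ∀ {b} → T b → b ≡ true
T⇒≡true = Equivalence.to T-≡

module _ {n : ℕ} (G : Graph n) (k : ℕ) (p : Fin n → Fin (suc k)) (layered : LayeredPartition G k p) where

  private
    F : VSet n
    F = Part p zero

    independent : ∀ (j : Fin k) → TwoIndependentIn G (UpTo p (suc (toℕ j))) (Part p (suc j))
    independent = proj₂ layered

    h : Fin n → ℕ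
    h = proj₁ (forest⇒levelling G F (proj₁ layered))

    levelling : IsLevelling G F h
    levelling = proj₂ (forest⇒levelling G F (proj₁ layered))

  colour : Fin n → Fin k ⊎ Fin 3
  colour v = layerColour (p v) (h v)

  colour-layer : ∀ {u v} → colour u ≡ colour v → p u ≡ p v
  colour-layer {u} {v} = layerColour-layer (p u) (p v)

  ∈F : ∀ {v} → p v ≡ zero → F v ≡ true
  ∈F pv rewrite pv = refl

  ∈I : ∀ {v j} → p v ≡ suc j → Part p (suc j) v ≡ true
  ∈I {j = j} pv rewrite pv = T⇒≡true (≡⇒≡ᵇ (toℕ j) (toℕ j) refl)

  ∈UpTo : ∀ {v m} → toℕ (p v) ≤ m → UpTo p m v ≡ true
  ∈UpTo = T⇒≡true ∘ ≤⇒≤ᵇ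

  F-colour≡⇒mod3≡ : ∀ {u v} → p u ≡ zero → p v ≡ zero →
                    colour u ≡ colour v → mod3 (h u) ≡ mod3 (h v)
  F-colour≡⇒mod3≡ pu pv eq rewrite pu | pv = inj₂-injective eq

  noCommonNeighbour : ∀ {u m w j} → u ≢ w → p u ≡ suc j → p w ≡ suc j → Adj G u m → Adj G m w →
    toℕ (p m) ≤ suc (toℕ j) → ⊥
  noCommonNeighbour {u} {m} {w} {j} u≢w pu pw u~m m~w pm≤ =
    proj₂ (independent j u w (∈I pu) (∈I pw) u≢w) m (∈UpTo pm≤) (u~m , m~w)

  lowerMiddle⇒forest : ∀ {u m w} → Adj G u m → Adj G m w → u ≢ w → p u ≡ p w → toℕ (p m) ≤ toℕ (p u) →
    p u ≡ zero × p m ≡ zero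
  lowerMiddle⇒forest {u} u~m m~w u≢w pu≡pw pm≤pu with p u in pu
  ... | zero = refl , toℕ-injective (n≤0⇒n≡0 pm≤pu)
  ... | suc j = ⊥-elim (noCommonNeighbour u≢w pu (≡.sym pu≡pw) u~m m~w pm≤pu)

  colour-proper : ∀ {u v} → Adj G u v → colour u ≢ colour v
  colour-proper {u} {v} u~v eq with p u in pu | colour-layer eq
  ... | zero | pv =
    levelColour-proper G levelling (∈F pu) (∈F (≡.sym pv)) u~v (F-colour≡⇒mod3≡ pu (≡.sym pv) eq)
  ... | suc j | pv = proj₁ (independent j u v (∈I pu) (∈I (≡.sym pv)) (adj⇒≢ G u~v)) u~v

  F-noAlternatingP4 : ∀ {a b c d} → p a ≡ zero → p b ≡ zero → p c ≡ zero → p d ≡ zero →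
    ¬ AlternatingP4 G colour a b c d
  F-noAlternatingP4 pa pb pc pd (path , distinct , ac , bd) =
    levelColour-noAlternatingP4 G levelling (∈F pa) (∈F pb) (∈F pc) (∈F pd)
      (path , distinct , F-colour≡⇒mod3≡ pa pc ac , F-colour≡⇒mod3≡ pb pd bd)

  -- Of the same-coloured pairs {a, c} and {b, d}, the one in the higher layer has its common neighbour on
  -- the path in a layer no higher, which 2-independence forbids unless every vertex lies in F.
  colour-noAlternatingP4 : ∀ {a b c d} → ¬ AlternatingP4 G colour a b c d
  colour-noAlternatingP4 {a} {b} P4@((a~b , b~c , c~d) , (a≢c , b≢d) , ac , bd)
    with colour-layer ac | colour-layer bd | ≤-total (toℕ (p b)) (toℕ (p a))
  ... | pa≡pc | pb≡pd | inj₁ pb≤pa =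
    let pa , pb = lowerMiddle⇒forest a~b b~c a≢c pa≡pc pb≤pa
    in F-noAlternatingP4 pa pb (trans (≡.sym pa≡pc) pa) (trans (≡.sym pb≡pd) pb) P4
  ... | pa≡pc | pb≡pd | inj₂ pa≤pb =
    let pb , pc = lowerMiddle⇒forest b~c c~d b≢d pb≡pd (subst (λ q → toℕ q ≤ toℕ (p b)) pa≡pc pa≤pb)
    in F-noAlternatingP4 (trans pa≡pc pc) pb pc (trans (≡.sym pb≡pd) pb) P4

  layered⇒starColouring : StarColoring G (k + 3)
  layered⇒starColouring = starColouring G colour (join k 3) (join-injective k 3) colour-proper colour-noAlternatingP4

forest⇒starColouring : ∀ {n} (T : Graph n) → IsForest T → StarChromatic≤ T 3
forest⇒starColouring T forest = layered⇒starColouring T 0 (const zero) (forest , λ ())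

indicator : ∀ {n} → VSet n → Fin n → Fin 2
indicator I v = if I v then suc zero else zero

module _ {n : ℕ} (I : VSet n) where

  indicator-zero : Part (indicator I) zero ⊆ (not ∘ I)
  indicator-zero v with I v
  ... | false = λ _ → refl
  ... | true = λ ()

  indicator-one : Part (indicator I) (suc zero) ⊆ I
  indicator-one v with I v
  ... | true = λ _ → refl
  ... | false = λ ()

ifPartition⇒layered : ∀ {n} (G : Graph n) (I : VSet n) → IFPartition G I → LayeredPartition G 1 (indicator I)
ifPartition⇒layered G I (independent , forest) =
  forest-⊆ G (indicator-zero I) forest ,
  λ { zero → twoIndependent-⊆ G (λ _ _ → refl) (indicator-one I) independent }

ifPartition⇒starColouring : ∀ {n} (G : Graph n) (I : VSet n) → IFPartition G I → StarChromatic≤ G 4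
ifPartition⇒starColouring G I ifPartition =
  layered⇒starColouring G 1 (indicator I) (ifPartition⇒layered G I ifPartition)

lemma7p5 :
    (∀ {n} (T : Graph n) → IsForest T → StarChromatic≤ T 3) ×
    (∀ {n} (G : Graph n) (I : VSet n) → IFPartition G I → StarChromatic≤ G 4) ×
    (∀ {n} (G : Graph n) (k : ℕ) (p : Fin n → Fin (suc k)) →
      LayeredPartition G k p → StarChromatic≤ G (k + 3))
lemma7p5 = forest⇒starColouring , ifPartition⇒starColouring , layered⇒starColouring
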